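{- For every $n\ge 3$, the directed cycle $C_n$ (vertices $v_0,\dots,v_{n-1}$, arcs $(v_i,v_{i+1 \bmod n})$) satisfies $\mu(C_n)=2$.
   Context: A shortest directed $x,y$-path is a directed path (distinct vertices) from $x$ to $y$ of minimum length. A set $S\subseteq V(D)$ of a digraph $D$ is a mutual-visibility set if for all distinct $x,y\in S$ there exist a shortest directed $x,y$-path $P$ and a shortest directed $y,x$-path $Q$ such that $(S\cap V(P))\cup(S\cap V(Q))=\{x,y\}$; $\mu(D)$ is the maximum size of a mutual-visibility set. -}

module Defs where

open import Data.Nat using (ℕ; zero; suc; _≤_; _∸_)
open import Data.Fin using (Fin; toℕ)
open import Data.Fin.Subset using (Subset; _∈_; ∣_∣)
open import Data.List using (List; []; _∷_; length)
open import Data.List.Relation.Unary.Unique.Propositional using (Unique)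
import Data.List.Membership.Propositional as LM
open import Data.Product using (Σ; _×_; ∃; ∃-syntax)
open import Data.Sum using (_⊎_)
open import Relation.Binary.PropositionalEquality using (_≡_; _≢_)

record Digraph (n : ℕ) : Set₁ where
  field
    Arc : Fin n → Fin n → Set

open Digraph public

data Walk {n : ℕ} (D : Digraph n) : Fin n → Fin n → List (Fin n) → Set where
  here : ∀ x → Walk D x x (x ∷ [])
  step : ∀ {x z y vs} → Arc D x z → Walk D z y vs → Walk D x y (x ∷ vs)

IsPath : ∀ {n} (D : Digraph n) → Fin n → Fin n → List (Fin n) → Set
IsPath D x y vs = Walk D x y vs × Unique vs

pathLength : ∀ {n} → List (Fin n) → ℕ
pathLength vs = length vs ∸ 1

IsShortestPath : ∀ {n} (D : Digraph n) → Fin n → Fin n → List (Fin n) → Set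
IsShortestPath D x y vs =
  IsPath D x y vs × (∀ ws → IsPath D x y ws → pathLength vs ≤ pathLength ws)

IsMutualVisibilitySet : ∀ {n} (D : Digraph n) → Subset n → Set
IsMutualVisibilitySet {n} D S =
  ∀ x y → x ∈ S → y ∈ S → x ≢ y →
  Σ (List (Fin n)) λ P → Σ (List (Fin n)) λ Q →
    IsShortestPath D x y P × IsShortestPath D y x Q ×
    (∀ v → v ∈ S → (v LM.∈ P ⊎ v LM.∈ Q) → (v ≡ x ⊎ v ≡ y))

MuEquals : ∀ {n} (D : Digraph n) → ℕ → Set
MuEquals {n} D k =
  (Σ (Subset n) λ S → IsMutualVisibilitySet D S × ∣ S ∣ ≡ k) ×
  (∀ S → IsMutualVisibilitySet D S → ∣ S ∣ ≤ k)

-- Directed cycle C_n on v_0,…,v_{n-1}: arc v_i → v_j iff j = (i + 1) mod n.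
-- (i + 1) mod n is i + 1 when i + 1 < n, and 0 when i + 1 = n.
DirectedCycle : (n : ℕ) → Digraph n
DirectedCycle n = record
  { Arc = λ i j → (suc (toℕ i) ≡ toℕ j) ⊎ (suc (toℕ i) ≡ n × toℕ j ≡ 0) }

{-# OPTIONS --safe #-}
-- Every vertex of the directed cycle has exactly one out-neighbour, so between two vertices
-- there is only one path, which is therefore shortest, and the x,y-path runs through the whole
-- clockwise arc from x to y. For distinct x, y in a mutual-visibility set, every vertex lies on
-- the arc from x to y or on the arc from y to x, hence on P or on Q, so the set is {x, y}.
-- Conversely {v₀, v₁} is mutual-visibility, witnessed by the paths v₀v₁ and v₁v₂⋯v₀.
module Submission where

open import Defs
open import Data.Nat using (ℕ; suc; _+_; _≤_; _<_; z≤n; s≤s; _≤?_)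
open import Data.Nat.Properties
  using (≤-refl; ≤-reflexive; ≤-trans; ≤-antisym; <⇒≤; <-irrefl; <-cmp; ≰⇒>; ≤∧≢⇒<; <⇒≱; m≤n⇒m≤1+n; m<1+n⇒m≤n; +-suc)
open import Data.Fin as Fin using (Fin; toℕ; inject₁; fromℕ) renaming (zero to fzero; suc to fsuc)
open import Data.Fin.Properties using (toℕ-injective; toℕ<n; toℕ-inject₁; toℕ-fromℕ; any?; <⇒≢; ≤̄⇒inject₁<) renaming (_≟_ to _≟ᶠ_)
open import Data.Fin.Induction using (>-weakInduction)
open import Data.Fin.Subset using (Subset; inside; outside; ⊥; ⁅_⁆; _∪_; _∈_; _⊆_; ∣_∣)
open import Data.Fin.Subset.Properties
  using (_∈?_; nonempty?; Empty-unique; ∣⊥∣≡0; ∣⁅x⁆∣≡1; x∈⁅x⁆; x∈⁅y⁆⇒x≡y; x∈p∪q⁺; x∈p∪q⁻; p⊆q⇒∣p∣≤∣q∣; ∪-idem)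
open import Data.Vec using ([]; _∷_)
open import Data.List using (List) renaming ([] to []ᴸ; _∷_ to _∷ᴸ_)
open import Data.List.Relation.Unary.All as All using (All) renaming ([] to []ᴬ; _∷_ to _∷ᴬ_)
open import Data.List.Relation.Unary.Any using (here; there)
open import Data.List.Relation.Unary.AllPairs using () renaming ([] to []ᴾ; _∷_ to _∷ᴾ_)
open import Data.List.Relation.Unary.Unique.Propositional.Properties using (Unique[x∷xs]⇒x∉xs)
import Data.List.Membership.Propositional as LM
open import Data.Product using (∃; _×_; _,_; proj₁; proj₂)
open import Data.Sum using (_⊎_; inj₁; inj₂; swap) renaming (map to map⊎)
open import Function using (_∘_; id)
open import Relation.Nullary using (yes; no; contradiction; ¬?)
open import Relation.Binary.Definitions using (tri<; tri≈; tri>)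
open import Relation.Nullary.Decidable using (_×-dec_; decidable-stable)
open import Relation.Binary.PropositionalEquality using (_≡_; _≢_; refl; sym; trans; cong; cong₂; subst)

private
  variable
    n : ℕ
    D : Digraph n
    x y : Fin n
    p : Subset n
    P Q vs : List (Fin n)

Walk⇒target∈ : Walk D x y vs → y LM.∈ vs
Walk⇒target∈ (here _)   = here refl
Walk⇒target∈ (step _ w) = there (Walk⇒target∈ w)

Deterministic : Digraph n → Set
Deterministic D = ∀ {x y z} → Arc D x y → Arc D x z → y ≡ z

deterministic⇒path-unique : Deterministic D → IsPath D x y P → IsPath D x y Q → P ≡ Q
deterministic⇒path-unique det (here _ , _) (here _ , _) = refl
deterministic⇒path-unique det (here _ , _) (step _ w , u) =
  contradiction (Walk⇒target∈ w) (Unique[x∷xs]⇒x∉xs u)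
deterministic⇒path-unique det (step _ w , u) (here _ , _) =
  contradiction (Walk⇒target∈ w) (Unique[x∷xs]⇒x∉xs u)
deterministic⇒path-unique det (step a w , _ ∷ᴾ u) (step a′ w′ , _ ∷ᴾ u′) with det a a′
... | refl = cong (_ ∷ᴸ_) (deterministic⇒path-unique det (w , u) (w′ , u′))

deterministic⇒path-shortest : Deterministic D → IsPath D x y P → IsShortestPath D x y P
deterministic⇒path-shortest det path =
  path , λ _ path′ → ≤-reflexive (cong pathLength (deterministic⇒path-unique det path path′))

∈⁅x⁆∪⁅y⁆⇒≡⊎≡ : ∀ {v} → v ∈ ⁅ x ⁆ ∪ ⁅ y ⁆ → v ≡ x ⊎ v ≡ y
∈⁅x⁆∪⁅y⁆⇒≡⊎≡ {x = x} {y} v∈ = map⊎ (x∈⁅y⁆⇒x≡y x) (x∈⁅y⁆⇒x≡y y) (x∈p∪q⁻ ⁅ x ⁆ ⁅ y ⁆ v∈)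

≡⊎≡⇒∈⁅x⁆∪⁅y⁆ : ∀ {v} → v ≡ x ⊎ v ≡ y → v ∈ ⁅ x ⁆ ∪ ⁅ y ⁆
≡⊎≡⇒∈⁅x⁆∪⁅y⁆ (inj₁ refl) = x∈p∪q⁺ (inj₁ (x∈⁅x⁆ _))
≡⊎≡⇒∈⁅x⁆∪⁅y⁆ (inj₂ refl) = x∈p∪q⁺ (inj₂ (x∈⁅x⁆ _))

pair-isMutualVisibilitySet : IsShortestPath D x y P → IsShortestPath D y x Q →
                             IsMutualVisibilitySet D (⁅ x ⁆ ∪ ⁅ y ⁆)
pair-isMutualVisibilitySet {P = P} {Q = Q} sp sq a b a∈ b∈ a≢b
  with ∈⁅x⁆∪⁅y⁆⇒≡⊎≡ a∈ | ∈⁅x⁆∪⁅y⁆⇒≡⊎≡ b∈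
... | inj₁ refl | inj₁ refl = contradiction refl a≢b
... | inj₂ refl | inj₂ refl = contradiction refl a≢b
... | inj₁ refl | inj₂ refl = P , Q , sp , sq , λ v v∈ _ → ∈⁅x⁆∪⁅y⁆⇒≡⊎≡ v∈
... | inj₂ refl | inj₁ refl = Q , P , sq , sp , λ v v∈ _ → swap (∈⁅x⁆∪⁅y⁆⇒≡⊎≡ v∈)

∣p∪q∣≤∣p∣+∣q∣ : (p q : Subset n) → ∣ p ∪ q ∣ ≤ ∣ p ∣ + ∣ q ∣
∣p∪q∣≤∣p∣+∣q∣ []            []            = z≤n
∣p∪q∣≤∣p∣+∣q∣ (outside ∷ p) (outside ∷ q) = ∣p∪q∣≤∣p∣+∣q∣ p q
∣p∪q∣≤∣p∣+∣q∣ (outside ∷ p) (inside  ∷ q) =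
  ≤-trans (s≤s (∣p∪q∣≤∣p∣+∣q∣ p q)) (≤-reflexive (sym (+-suc ∣ p ∣ ∣ q ∣)))
∣p∪q∣≤∣p∣+∣q∣ (inside  ∷ p) (outside ∷ q) = s≤s (∣p∪q∣≤∣p∣+∣q∣ p q)
∣p∪q∣≤∣p∣+∣q∣ (inside  ∷ p) (inside  ∷ q) =
  s≤s (≤-trans (m≤n⇒m≤1+n (∣p∪q∣≤∣p∣+∣q∣ p q)) (≤-reflexive (sym (+-suc ∣ p ∣ ∣ q ∣))))

⊆⁅x⁆∪⁅y⁆⇒∣p∣≤2 : p ⊆ ⁅ x ⁆ ∪ ⁅ y ⁆ → ∣ p ∣ ≤ 2
⊆⁅x⁆∪⁅y⁆⇒∣p∣≤2 {x = x} {y} p⊆ = ≤-trans (p⊆q⇒∣p∣≤∣q∣ p⊆) (≤-trans (∣p∪q∣≤∣p∣+∣q∣ ⁅ x ⁆ ⁅ y ⁆)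
  (≤-reflexive (cong₂ _+_ (∣⁅x⁆∣≡1 x) (∣⁅x⁆∣≡1 y))))

within-every-pair⇒∣p∣≤2 : (∀ {x y v} → x ∈ p → y ∈ p → x ≢ y → v ∈ p → v ≡ x ⊎ v ≡ y) → ∣ p ∣ ≤ 2
within-every-pair⇒∣p∣≤2 {n} {p} within with nonempty? p
... | no empty = ≤-trans (≤-reflexive (trans (cong ∣_∣ (Empty-unique empty)) (∣⊥∣≡0 n))) z≤n
... | yes (x , x∈p) with any? (λ y → y ∈? p ×-dec ¬? (x ≟ᶠ y))
...   | yes (y , y∈p , x≢y) = ⊆⁅x⁆∪⁅y⁆⇒∣p∣≤2 (≡⊎≡⇒∈⁅x⁆∪⁅y⁆ ∘ within x∈p y∈p x≢y)
...   | no  no-other        = ⊆⁅x⁆∪⁅y⁆⇒∣p∣≤2 {y = x} λ {v} v∈p →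
  ≡⊎≡⇒∈⁅x⁆∪⁅y⁆ (inj₁ (decidable-stable (v ≟ᶠ x) λ v≢x → no-other (v , v∈p , v≢x ∘ sym)))

last-has-no-successor : {u v : Fin n} → suc (toℕ u) ≡ n → suc (toℕ u) ≢ toℕ v
last-has-no-successor {v = v} u+1≡n u+1≡v = <-irrefl (trans (sym u+1≡v) u+1≡n) (toℕ<n v)

directedCycle-deterministic : Deterministic (DirectedCycle n)
directedCycle-deterministic (inj₁ x→y)        (inj₁ x→z)        = toℕ-injective (trans (sym x→y) x→z)
directedCycle-deterministic (inj₂ (_ , y≡0))  (inj₂ (_ , z≡0))  = toℕ-injective (trans y≡0 (sym z≡0))
directedCycle-deterministic (inj₁ x→y)        (inj₂ (x+1≡n , _)) = contradiction x→y (last-has-no-successor x+1≡n)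
directedCycle-deterministic (inj₂ (x+1≡n , _)) (inj₁ x→z)        = contradiction x→z (last-has-no-successor x+1≡n)

-- The positions passed when going round the cycle from position a to position b.
data CyclicInterval (a b : ℕ) : ℕ → Set where
  direct        : ∀ {v} → a ≤ v → v ≤ b → CyclicInterval a b v
  wrapped-above : ∀ {v} → b < a → a ≤ v → CyclicInterval a b v
  wrapped-below : ∀ {v} → b < a → v ≤ b → CyclicInterval a b v

cyclicInterval-total : ∀ {a b} → a ≢ b → ∀ v → CyclicInterval a b v ⊎ CyclicInterval b a v
cyclicInterval-total {a} {b} a≢b v with <-cmp a b | a ≤? v | v ≤? b | b ≤? v | v ≤? a
... | tri≈ _ a≡b _ | _ | _ | _ | _ = contradiction a≡b a≢b
... | tri< a<b _ _ | yes a≤v | yes v≤b | _ | _ = inj₁ (direct a≤v v≤b)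
... | tri< a<b _ _ | no a≰v | _ | _ | _ = inj₂ (wrapped-below a<b (<⇒≤ (≰⇒> a≰v)))
... | tri< a<b _ _ | yes _ | no v≰b | _ | _ = inj₂ (wrapped-above a<b (<⇒≤ (≰⇒> v≰b)))
... | tri> _ _ b<a | _ | _ | yes b≤v | yes v≤a = inj₂ (direct b≤v v≤a)
... | tri> _ _ b<a | _ | _ | no b≰v | _ = inj₁ (wrapped-below b<a (<⇒≤ (≰⇒> b≰v)))
... | tri> _ _ b<a | _ | _ | yes _ | no v≰a = inj₁ (wrapped-above b<a (<⇒≤ (≰⇒> v≰a)))

-- The arc is that of DirectedCycle n between the positions u and w, stated on ℕ so that it can
-- be matched on.
cyclicInterval-advance : ∀ {u w b v} → (suc u ≡ w ⊎ (suc u ≡ n × w ≡ 0)) → v < n → v ≢ u →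
                         CyclicInterval u b v → CyclicInterval w b v
cyclicInterval-advance (inj₁ refl) _ v≢u (direct u≤v v≤b) = direct (≤∧≢⇒< u≤v (v≢u ∘ sym)) v≤b
cyclicInterval-advance (inj₁ refl) _ v≢u (wrapped-above b<u u≤v) =
  wrapped-above (m≤n⇒m≤1+n b<u) (≤∧≢⇒< u≤v (v≢u ∘ sym))
cyclicInterval-advance (inj₁ refl) _ _ (wrapped-below b<u v≤b) = wrapped-below (m≤n⇒m≤1+n b<u) v≤b
cyclicInterval-advance (inj₂ (u+1≡n , refl)) v<n v≢u (direct u≤v _) =
  contradiction (m<1+n⇒m≤n (subst (_ <_) (sym u+1≡n) v<n)) (<⇒≱ (≤∧≢⇒< u≤v (v≢u ∘ sym)))
cyclicInterval-advance (inj₂ (u+1≡n , refl)) v<n v≢u (wrapped-above _ u≤v) =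
  contradiction (m<1+n⇒m≤n (subst (_ <_) (sym u+1≡n) v<n)) (<⇒≱ (≤∧≢⇒< u≤v (v≢u ∘ sym)))
cyclicInterval-advance (inj₂ (_ , refl)) _ _ (wrapped-below _ v≤b) = direct z≤n v≤b

walk-covers-cyclicInterval : Walk (DirectedCycle n) x y vs → ∀ v →
                             CyclicInterval (toℕ x) (toℕ y) (toℕ v) → v LM.∈ vs
walk-covers-cyclicInterval (here _) v (direct x≤v v≤x)    = here (toℕ-injective (≤-antisym v≤x x≤v))
walk-covers-cyclicInterval (here _) v (wrapped-above x<x _) = contradiction x<x (<-irrefl refl)
walk-covers-cyclicInterval (here _) v (wrapped-below x<x _) = contradiction x<x (<-irrefl refl)
walk-covers-cyclicInterval (step {x = x} x→z w) v v∈[x,y] with v ≟ᶠ x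
... | yes v≡x = here v≡x
... | no  v≢x = there (walk-covers-cyclicInterval w v
  (cyclicInterval-advance x→z (toℕ<n v) (v≢x ∘ toℕ-injective) v∈[x,y]))

mutualVisibilitySet-within-pair : IsMutualVisibilitySet (DirectedCycle n) p →
  ∀ {x y v} → x ∈ p → y ∈ p → x ≢ y → v ∈ p → v ≡ x ⊎ v ≡ y
mutualVisibilitySet-within-pair mv {x} {y} {v} x∈p y∈p x≢y v∈p
  with mv x y x∈p y∈p x≢y | cyclicInterval-total (x≢y ∘ toℕ-injective) (toℕ v)
... | _ , _ , ((walkP , _) , _) , _ , visible | inj₁ v∈[x,y] =
  visible v v∈p (inj₁ (walk-covers-cyclicInterval walkP v v∈[x,y]))
... | _ , _ , _ , ((walkQ , _) , _) , visible | inj₂ v∈[y,x] =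
  visible v v∈p (inj₂ (walk-covers-cyclicInterval walkQ v v∈[y,x]))

ascendingPathToZero : ∀ {k} (i : Fin (suc k)) → i ≢ fzero →
  ∃ λ vs → IsPath (DirectedCycle (suc k)) i fzero vs × All (λ v → i Fin.≤ v ⊎ v ≡ fzero) vs
ascendingPathToZero {k} = >-weakInduction Reaches0 last advance
  where
  Reaches0 : Fin (suc k) → Set
  Reaches0 i = i ≢ fzero →
    ∃ λ vs → IsPath (DirectedCycle (suc k)) i fzero vs × All (λ v → i Fin.≤ v ⊎ v ≡ fzero) vs

  last : Reaches0 (fromℕ k)
  last k≢0 = fromℕ k ∷ᴸ fzero ∷ᴸ []ᴸ
           , (step (inj₂ (cong suc (toℕ-fromℕ k) , refl)) (here fzero) , (k≢0 ∷ᴬ []ᴬ) ∷ᴾ ([]ᴬ ∷ᴾ []ᴾ))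
           , inj₁ ≤-refl ∷ᴬ inj₂ refl ∷ᴬ []ᴬ

  advance : ∀ i → Reaches0 (fsuc i) → Reaches0 (inject₁ i)
  advance i P[i+1] i≢0 with P[i+1] (λ ())
  ... | vs , (walk , unique) , above =
    inject₁ i ∷ᴸ vs , (step (inj₁ (cong suc (toℕ-inject₁ i))) walk , All.map distinct above ∷ᴾ unique)
    , inj₁ ≤-refl ∷ᴬ All.map weaken above
    where
    i<i+1 : inject₁ i Fin.< fsuc i
    i<i+1 = ≤̄⇒inject₁< ≤-refl
    distinct : ∀ {v} → fsuc i Fin.≤ v ⊎ v ≡ fzero → inject₁ i ≢ v
    distinct (inj₁ i+1≤v) = <⇒≢ (≤-trans i<i+1 i+1≤v)
    distinct (inj₂ refl)  = i≢0
    weaken : ∀ {v} → fsuc i Fin.≤ v ⊎ v ≡ fzero → inject₁ i Fin.≤ v ⊎ v ≡ fzero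
    weaken = map⊎ (≤-trans (<⇒≤ i<i+1)) id

mainTheorem8 : (n : ℕ) → 3 ≤ n → MuEquals (DirectedCycle n) 2
mainTheorem8 (suc (suc (suc m))) _ =
  (S₀ , pair-isMutualVisibilitySet (shortest path01) (shortest path10) , card)
  , λ S mv → within-every-pair⇒∣p∣≤2 (mutualVisibilitySet-within-pair mv)
  where
  C : Digraph (3 + m)
  C = DirectedCycle (3 + m)

  S₀ : Subset (3 + m)
  S₀ = ⁅ fzero ⁆ ∪ ⁅ fsuc fzero ⁆

  shortest : ∀ {x y vs} → IsPath C x y vs → IsShortestPath C x y vs
  shortest = deterministic⇒path-shortest directedCycle-deterministic

  path01 : IsPath C fzero (fsuc fzero) (fzero ∷ᴸ fsuc fzero ∷ᴸ []ᴸ)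
  path01 = step (inj₁ refl) (here _) , ((λ ()) ∷ᴬ []ᴬ) ∷ᴾ ([]ᴬ ∷ᴾ []ᴾ)

  path10 : IsPath C (fsuc fzero) fzero (proj₁ (ascendingPathToZero (fsuc fzero) λ ()))
  path10 = proj₁ (proj₂ (ascendingPathToZero (fsuc fzero) λ ()))

  card : ∣ S₀ ∣ ≡ 2
  card = cong (2 +_) (trans (cong ∣_∣ (∪-idem (⊥ {n = suc m}))) (∣⊥∣≡0 (suc m)))
mainTheorem8 0                 ()
mainTheorem8 1                 (s≤s ())
mainTheorem8 2                 (s≤s (s≤s ()))
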